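{- Let $n\ge1$ and let $\lambda,\mu$ be partitions with at most $n$ parts (padded with zeros to exactly $n$ parts). Then $Z_\lambda(a_\mu|a)=0$ unless $\lambda\subset\mu$, and \[ Z_\lambda(a_\lambda|a)=\prod_{(i,j)\in\lambda}\left(\frac{a_{n+1-i+\lambda_i}}{a_{n-\lambda'_j+j}}-1\right), \] the product being over the cells $(i,j)$ (row $i$, column $j$) of the Young diagram of $\lambda$.
   Context: For a partition $\mu=(\mu_1,\ldots,\mu_n)$, $a_\mu$ denotes the sequence $((a_\mu)_1,\ldots,(a_\mu)_n)$ with $(a_\mu)_i=a_{n+1-i+\mu_i}$, and $Z_\lambda(a_\mu|a)$ means $Z_\lambda(x|a)$ with $x_i$ replaced by $a_{n+1-i+\mu_i}$ for each $i$. $\lambda'$ is the conjugate partition, and $\lambda\subset\mu$ means $\lambda_i\le\mu_i$ for all $i$. Let $\lambda=(\lambda_1\ge\cdots\ge\lambda_n\ge0)$. Consider the grid of vertices $(r,c)$, $1\le r\le n$ (rows, top to bottom), $1\le c\le n+\lambda_1$ (columns, left to right), with horizontal edges between $(r,c),(r,c+1)$, vertical edges between $(r,c),(r+1,c)$, and boundary edges: a west boundary edge at each vertex of column 1, an east one at each vertex of column $n+\lambda_1$, a north one at each vertex of row 1, a south one at each vertex of row $n$. A state places on every edge one hydrogen atom bonded to exactly one endpoint (for boundary edges: its grid vertex or the outside) so that every vertex is bonded to exactly two of the hydrogens on its four incident edges. The $\lambda$-boundary condition: all west and east boundary hydrogens are bonded to their grid vertex, no south boundary hydrogen is, and the north boundary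 hydrogen in column $c$ is bonded to $(1,c)$ iff $c\notin\{\lambda_k+n+1-k:1\le k\le n\}$. The weight of vertex $(r,c)$ is $x_r/a_c$ if its bonded hydrogens are on its north and south edges, $x_r/a_c-1$ if on its north and west edges, and $1$ otherwise. $Z_\lambda(x|a)$, with $x_1,\ldots,x_n,a_1,a_2,\ldots$ indeterminates, is the sum over all states with the $\lambda$-boundary condition of the product of all vertex weights. -}

module Defs where

open import Data.Bool using (Bool; true; false; _∧_; _∨_; not; if_then_else_)
open import Data.Nat as ℕ using (ℕ; zero; suc; _∸_; _≡ᵇ_; _≤ᵇ_)
open import Data.Fin using (Fin; zero; suc; toℕ)
open import Data.List as List using (List; []; _∷_; concatMap; allFin; upTo; filter)
open import Data.Bool.ListAction as BLA using ()
open import Data.Rational as ℚ using (ℚ; 0ℚ; 1ℚ; _≟_; ≢-nonZero; _÷_)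
open import Relation.Nullary using (yes; no)
open import Relation.Nullary.Decidable using (does)
open import Relation.Binary.PropositionalEquality using (_≡_)

-- Total division on ℚ (only ever used with nonzero denominators in the
-- main theorem, where all a_c are assumed nonzero).

divQ : ℚ → ℚ → ℚ
divQ p q with q ≟ 0ℚ
... | yes _ = 0ℚ
... | no ne = _÷_ p q {{≢-nonZero ne}}

sumQ : List ℚ → ℚ
sumQ = List.foldr ℚ._+_ 0ℚ

prodQ : List ℚ → ℚ
prodQ = List.foldr ℚ._*_ 1ℚ

allFuns : ∀ {A : Set} → List A → (m : ℕ) → List (Fin m → A)
allFuns xs zero = (λ ()) ∷ []
allFuns xs (suc m) =
  concatMap (λ x → List.map (λ f → λ { zero → x ; (suc i) → f i }) (allFuns xs m)) xs

allBools : List Bool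
allBools = true ∷ false ∷ []

-- Partitions with exactly n (possibly zero) parts, 0-indexed:
-- part i (i : Fin n) is λ_{i+1}.

IsPartition : {n : ℕ} → (Fin n → ℕ) → Set
IsPartition {n} p = ∀ (i j : Fin n) → toℕ i ℕ.≤ toℕ j → p j ℕ.≤ p i

_⊆ₚ_ : {n : ℕ} → (Fin n → ℕ) → (Fin n → ℕ) → Set
_⊆ₚ_ {n} p q = ∀ (i : Fin n) → p i ℕ.≤ q i

firstPart : {n : ℕ} → (Fin n → ℕ) → ℕ
firstPart {zero} p = 0
firstPart {suc n} p = p zero

conj : {n : ℕ} → (Fin n → ℕ) → ℕ → ℕ
conj {n} p j = List.length (filter (λ i → j ℕ.≤? p i) (allFin n))

-- Lattice model.  Rows r : Fin n  (row r+1),  columns c : Fin N (column c+1),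
-- N = n + λ_1.
--
-- Horizontal edges in row r:  H r k, k : Fin (suc N).  Edge k lies to the
-- west of column k (k = 0 is the west boundary edge) and to the east of
-- column k-1 (k = N is the east boundary edge).
--   H r k = true  iff its hydrogen is bonded to its WEST endpoint
--   (for k = 0 the west endpoint is the outside).
-- Vertical edges in column c:  V k c, k : Fin (suc n).  Edge k lies to the
-- north of row k (k = 0 is the north boundary edge) and south of row k-1
-- (k = n is the south boundary edge).
--   V k c = true  iff its hydrogen is bonded to its NORTH endpoint
--   (for k = 0 the north endpoint is the outside).

record State (n N : ℕ) : Set where
  constructor st
  field
    H : Fin n → Fin (suc N) → Bool
    V : Fin (suc n) → Fin N → Bool

open State public

allStates : (n N : ℕ) → List (State n N)
allStates n N =
  concatMap (λ h → List.map (st h) (allFuns (allFuns allBools N) (suc n)))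
            (allFuns (allFuns allBools (suc N)) n)

module _ {n N : ℕ} (s : State n N) (r : Fin n) (c : Fin N) where
  bW bE bN bS : Bool
  bW = not (H s r (Data.Fin.inject₁ c))
  bE = H s r (suc c)
  bN = not (V s (Data.Fin.inject₁ r) c)
  bS = V s (suc r) c

count : List Bool → ℕ
count bs = List.length (filter (λ b → b Data.Bool.≟ true) bs)

vertexOK : {n N : ℕ} → State n N → Fin n → Fin N → Bool
vertexOK s r c = count (bW s r c ∷ bE s r c ∷ bN s r c ∷ bS s r c ∷ []) ≡ᵇ 2

allB : {m : ℕ} → (Fin m → Bool) → Bool
allB {m} f = BLA.all f (allFin m)

-- 1-indexed column c belongs to { λ_k + n + 1 - k : 1 ≤ k ≤ n }
inPartCols : {n : ℕ} → (Fin n → ℕ) → ℕ → Bool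
inPartCols {n} p c = BLA.any (λ k → c ≡ᵇ (p k ℕ.+ (n ∸ toℕ k))) (allFin n)

boolEq : Bool → Bool → Bool
boolEq true b = b
boolEq false b = not b

boundaryOK : {n N : ℕ} → (Fin n → ℕ) → State n N → Bool
boundaryOK {n} {N} p s =
     allB (λ r → not (H s r zero))                 -- west: bonded to grid vertex (its east endpoint)
  ∧  allB (λ r → H s r (Data.Fin.fromℕ N))          -- east: bonded to grid vertex (its west endpoint)
  ∧  allB (λ c → not (V s (Data.Fin.fromℕ n) c))    -- south: not bonded to grid vertex (its north endpoint)
  ∧  allB (λ c → boolEq (not (V s zero c))          -- north: bonded to (1,c) iff column c+1 ∉ {λ_k+n+1-k}
                        (not (inPartCols p (suc (toℕ c)))))

validState : {n N : ℕ} → (Fin n → ℕ) → State n N → Bool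
validState p s = allB (λ r → allB (λ c → vertexOK s r c)) ∧ boundaryOK p s

-- Weights.  x r = x_{r+1};  a c = a_c (1-indexed; a 0 is never used).

vertexWeight : {n N : ℕ} → (Fin n → ℚ) → (ℕ → ℚ) → State n N → Fin n → Fin N → ℚ
vertexWeight x a s r c =
  if bN s r c ∧ bS s r c then divQ (x r) (a (suc (toℕ c)))
  else if bN s r c ∧ bW s r c then divQ (x r) (a (suc (toℕ c))) ℚ.- 1ℚ
  else 1ℚ

stateWeight : {n N : ℕ} → (Fin n → ℚ) → (ℕ → ℚ) → State n N → ℚ
stateWeight {n} {N} x a s =
  prodQ (List.map (λ r → prodQ (List.map (λ c → vertexWeight x a s r c) (allFin N))) (allFin n))

Z : (n : ℕ) → (Fin n → ℕ) → (Fin n → ℚ) → (ℕ → ℚ) → ℚ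
Z n p x a =
  sumQ (List.map (stateWeight x a)
         (filter (λ s → validState p s Data.Bool.≟ true) (allStates n (n ℕ.+ firstPart p))))

-- (a_μ)_i = a_{n+1-i+μ_i}; 0-indexed i : Fin n gives a_{μ_i + (n - i)}
aSub : {n : ℕ} → (ℕ → ℚ) → (Fin n → ℕ) → Fin n → ℚ
aSub {n} a q i = a (q i ℕ.+ (n ∸ toℕ i))

-- ∏_{(i,j) ∈ λ} ( a_{n+1-i+λ_i} / a_{n-λ'_j+j} - 1 )   (i 0-indexed, j 1-indexed)
hookProd : {n : ℕ} → (ℕ → ℚ) → (Fin n → ℕ) → ℚ
hookProd {n} a p =
  prodQ (List.map (λ i → prodQ (List.map
           (λ j → divQ (a (p i ℕ.+ (n ∸ toℕ i))) (a ((n ∸ conj p j) ℕ.+ j)) ℚ.- 1ℚ)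
           (List.map suc (upTo (p i)))))
         (allFin n))

{-# OPTIONS --safe #-}
-- The ice rule turns the states with the λ-boundary condition into families of n up-right
-- lattice paths, one entering from the west in every row and one leaving through the top
-- in each column λ_k + n + 1 − k.  At x = a_μ a vertex of row r in column μ_r + n + 1 − r
-- whose hydrogens are bonded north and west has weight 0.  Counting the paths that cross a
-- horizontal line to the right of a given column shows that in a state without such
-- vertices at most i − 1 paths leave through the top right of column μ_i + n + 1 − i,
-- whereas the exits of rows 1, …, i supply i of them when λ_i > μ_i; so Z vanishes unless
-- λ ⊂ μ.  For μ = λ the same count determines the state completely, and its non-unit
-- weights sit at the north-west corners of each row i, which occupy exactly the columns
-- n − λ′_j + j (j = 1, …, λ_i) missed by the exits: this is the hook product.
module Submission where

open import Defs
open import Function using (_∘_; id; case_of_)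
open import Data.Bool as Bool using (Bool; true; false; _∧_; not; if_then_else_; T)
open import Data.Bool.Properties using (∧-zeroʳ; not-involutive)
open import Data.Bool.ListAction as BLA using ()
open import Data.Unit using (tt)
open import Data.Nat as ℕ using (ℕ; zero; suc; _+_; _∸_; _≤_; _<_; z≤n; s≤s; _≤ᵇ_; _≡ᵇ_; _≤?_; _<?_)
open import Data.Nat.Properties
open import Data.Nat.Solver using (module +-*-Solver)
open import Data.Fin using (Fin; zero; suc; toℕ; fromℕ; fromℕ<; inject₁)
open import Data.Fin.Properties using (toℕ<n; toℕ-fromℕ; toℕ-fromℕ<; toℕ-inject₁)
open import Data.List as List using (List; []; _∷_; _++_; tabulate; upTo; applyUpTo)
import Data.List.Properties as List
open import Data.Rational as ℚ using (ℚ; 0ℚ; 1ℚ)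
import Data.Rational.Properties as ℚP
open import Data.Product using (_×_; _,_; proj₁; proj₂; ∃)
open import Data.Sum using (_⊎_; inj₁; inj₂; [_,_]′)
open import Data.Empty using (⊥-elim)
open import Data.Vec.Functional.Relation.Binary.Pointwise using (Pointwise)
open import Relation.Nullary using (¬_; yes; no)
open import Relation.Nullary.Decidable using (_×-dec_)
open import Relation.Unary using (Decidable)
open import Relation.Binary.PropositionalEquality
open import Relation.Binary.Definitions using (tri<; tri≈; tri>)

open +-*-Solver using (solve; _:+_; _:=_)

private variable
  A B C : Set

sumQ-zero : (g : A → ℚ) (L : List A) → (∀ z → g z ≡ 0ℚ) → sumQ (List.map g L) ≡ 0ℚ
sumQ-zero g [] _ = refl
sumQ-zero g (x ∷ L) g≡0 rewrite g≡0 x | sumQ-zero g L g≡0 = ℚP.+-identityʳ 0ℚ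

sumQ-++ : (g : A → ℚ) (L M : List A) →
  sumQ (List.map g (L ++ M)) ≡ sumQ (List.map g L) ℚ.+ sumQ (List.map g M)
sumQ-++ g [] M = sym (ℚP.+-identityˡ _)
sumQ-++ g (x ∷ L) M rewrite sumQ-++ g L M = sym (ℚP.+-assoc (g x) _ _)

sumQ-concatMap : (g : B → ℚ) (h : A → List B) (L : List A) →
  sumQ (List.map g (List.concatMap h L)) ≡ sumQ (List.map (λ x → sumQ (List.map g (h x))) L)
sumQ-concatMap g h [] = refl
sumQ-concatMap g h (x ∷ L) =
  trans (sumQ-++ g (h x) (List.concatMap h L)) (cong (sumQ (List.map g (h x)) ℚ.+_) (sumQ-concatMap g h L))

sumQ-filter : (P : A → Bool) (w : A → ℚ) (L : List A) →
  sumQ (List.map w (List.filter (λ s → P s Bool.≟ true) L)) ≡ sumQ (List.map (λ s → if P s then w s else 0ℚ) L)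
sumQ-filter P w [] = refl
sumQ-filter P w (x ∷ L) with P x
... | true = cong (w x ℚ.+_) (sumQ-filter P w L)
... | false = trans (sumQ-filter P w L) (sym (ℚP.+-identityˡ _))

-- Up to ~, the list L contains y exactly once.
Isolates : {A : Set} → (A → A → Set) → List A → A → Set
Isolates {A} _~_ L y =
  ∀ (g : A → ℚ) → (∀ z → ¬ z ~ y → g z ≡ 0ℚ) → (∀ z → z ~ y → g z ≡ g y) → sumQ (List.map g L) ≡ g y

allBools-isolates : ∀ y → Isolates _≡_ allBools y
allBools-isolates true g off _ rewrite off false (λ ()) =
  trans (cong (g true ℚ.+_) (ℚP.+-identityʳ 0ℚ)) (ℚP.+-identityʳ _)
allBools-isolates false g off _ rewrite off true (λ ()) = trans (ℚP.+-identityˡ _) (ℚP.+-identityʳ _)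

concatMap-isolates : (R : A → A → Set) (S : B → B → Set) (mk : A → B → C) (L : List A) (M : List B) →
  (∀ y → R y y) → (∀ y → S y y) → (∀ y → Isolates R L y) → (∀ y → Isolates S M y) →
  ∀ y₁ y₂ (g : C → ℚ) → (∀ a b → ¬ (R a y₁ × S b y₂) → g (mk a b) ≡ 0ℚ) →
  (∀ a b → R a y₁ → S b y₂ → g (mk a b) ≡ g (mk y₁ y₂)) →
  sumQ (List.map g (List.concatMap (λ a → List.map (mk a) M) L)) ≡ g (mk y₁ y₂)
concatMap-isolates {A = A} R S mk L M reflR reflS isoL isoM y₁ y₂ g off on = begin
  sumQ (List.map g (List.concatMap (λ a → List.map (mk a) M) L))
    ≡⟨ sumQ-concatMap g _ L ⟩
  sumQ (List.map (λ a → sumQ (List.map g (List.map (mk a) M))) L)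
    ≡⟨ cong sumQ (List.map-cong (λ a → cong sumQ (sym (List.map-∘ M))) L) ⟩
  sumQ (List.map inner L)
    ≡⟨ isoL y₁ inner innerOff (λ a r → trans (innerOn a r) (sym (innerOn y₁ (reflR y₁)))) ⟩
  inner y₁
    ≡⟨ innerOn y₁ (reflR y₁) ⟩
  g (mk y₁ y₂) ∎
  where
  open ≡-Reasoning
  inner : A → ℚ
  inner a = sumQ (List.map (λ b → g (mk a b)) M)
  innerOff : ∀ a → ¬ R a y₁ → inner a ≡ 0ℚ
  innerOff a ¬r = sumQ-zero _ M (λ b → off a b (¬r ∘ proj₁))
  innerOn : ∀ a → R a y₁ → inner a ≡ g (mk y₁ y₂)
  innerOn a r = trans
    (isoM y₂ (λ b → g (mk a b)) (λ b ¬s → off a b (¬s ∘ proj₂))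
      (λ b s → trans (on a b r s) (sym (on a y₂ r (reflS y₂)))))
    (on a y₂ r (reflS y₂))

allFuns-isolates : (_~_ : A → A → Set) (xs : List A) → (∀ y → y ~ y) → (∀ y → Isolates _~_ xs y) →
  ∀ m (f : Fin m → A) → Isolates (Pointwise _~_) (allFuns xs m) f
allFuns-isolates _~_ xs refl~ iso zero f g off on = trans (ℚP.+-identityʳ _) (on _ (λ ()))
allFuns-isolates {A = A} _~_ xs refl~ iso (suc m) f g off on = viaCons _ (λ _ _ → refl) (λ _ _ _ → refl)
  where
  viaCons : (cons : A → (Fin m → A) → Fin (suc m) → A) →
    (∀ a h → cons a h zero ≡ a) → (∀ a h i → cons a h (suc i) ≡ h i) →
    sumQ (List.map g (List.concatMap (λ a → List.map (cons a) (allFuns xs m)) xs)) ≡ g f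
  viaCons cons cons-zero cons-suc =
    trans (concatMap-isolates _~_ (Pointwise _~_) cons xs (allFuns xs m) refl~ (λ h i → refl~ (h i))
             iso (allFuns-isolates _~_ xs refl~ iso m) (f zero) (f ∘ suc) g
             (λ a h ¬rs → off (cons a h) (λ p → ¬rs (subst (_~ f zero) (cons-zero a h) (p zero)
                                                   , λ i → subst (_~ f (suc i)) (cons-suc a h i) (p (suc i)))))
             (λ a h r s → trans (on _ (cons~f r s)) (sym (on _ (cons~f (refl~ _) (λ i → refl~ _))))))
          (on _ (cons~f (refl~ _) (λ i → refl~ _)))
    where
    cons~f : ∀ {a h} → a ~ f zero → Pointwise _~_ h (f ∘ suc) → Pointwise _~_ (cons a h) f
    cons~f {a} {h} r s zero = subst (_~ f zero) (sym (cons-zero a h)) r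
    cons~f {a} {h} r s (suc i) = subst (_~ f (suc i)) (sym (cons-suc a h i)) (s i)

SameState : {n N : ℕ} → State n N → State n N → Set
SameState s s' = Pointwise (Pointwise _≡_) (H s) (H s') × Pointwise (Pointwise _≡_) (V s) (V s')

allStates-isolates : ∀ n N (y : State n N) → Isolates SameState (allStates n N) y
allStates-isolates n N y g off on =
  concatMap-isolates _ _ st (allFuns (allFuns allBools (suc N)) n) (allFuns (allFuns allBools N) (suc n))
    (λ _ _ _ → refl) (λ _ _ _ → refl) (boolArrays (suc N) n) (boolArrays N (suc n))
    (H y) (V y) g (λ h v ¬hv → off (st h v) ¬hv) (λ h v hh vv → on (st h v) (hh , vv))
  where
  boolArrays : ∀ k m (f : Fin m → Fin k → Bool) → Isolates (Pointwise (Pointwise _≡_)) (allFuns (allFuns allBools k) m) f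
  boolArrays k m = allFuns-isolates _ _ (λ _ _ → refl) (allFuns-isolates _≡_ allBools (λ _ → refl) allBools-isolates k) m

bit : Bool → ℕ
bit true = 1
bit false = 0

bit≤1 : ∀ b → bit b ≤ 1
bit≤1 true = s≤s z≤n
bit≤1 false = z≤n

bit≡0⇒false : ∀ b → bit b ≡ 0 → b ≡ false
bit≡0⇒false false _ = refl

1≤bit⇒true : ∀ b → 1 ≤ bit b → b ≡ true
1≤bit⇒true true _ = refl

bit-injective : ∀ a b → bit a ≡ bit b → a ≡ b
bit-injective true true _ = refl
bit-injective false false _ = refl

true≢false : true ≢ false
true≢false ()

T⇒≡true : ∀ b → T b → b ≡ true
T⇒≡true true _ = refl

≤ᵇ-true : ∀ c q → c ≤ q → (c ≤ᵇ q) ≡ true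
≤ᵇ-true c q c≤q = T⇒≡true _ (≤⇒≤ᵇ c≤q)

≤ᵇ-false : ∀ c q → q < c → (c ≤ᵇ q) ≡ false
≤ᵇ-false c q q<c with c ≤ᵇ q in eq
... | false = refl
... | true = ⊥-elim (<⇒≱ q<c (≤ᵇ⇒≤ c q (subst T (sym eq) tt)))

≡ᵇ-true : ∀ c q → c ≡ q → (c ≡ᵇ q) ≡ true
≡ᵇ-true c q c≡q = T⇒≡true _ (≡⇒≡ᵇ c q c≡q)

≡ᵇ-false : ∀ c q → c ≢ q → (c ≡ᵇ q) ≡ false
≡ᵇ-false c q c≢q with c ≡ᵇ q in eq
... | false = refl
... | true = ⊥-elim (c≢q (≡ᵇ⇒≡ c q (subst T (sym eq) tt)))

≤ᵇ-split : ∀ c q → bit (c ≤ᵇ q) ≡ bit (c ≡ᵇ q) + bit (suc c ≤ᵇ q)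
≤ᵇ-split c q with <-cmp c q
... | tri< c<q c≢q _ rewrite ≤ᵇ-true c q (<⇒≤ c<q) | ≡ᵇ-false c q c≢q | ≤ᵇ-true (suc c) q c<q = refl
... | tri≈ _ c≡q _ rewrite ≤ᵇ-true c q (≤-reflexive c≡q) | ≡ᵇ-true c q c≡q
                         | ≤ᵇ-false (suc c) q (≤-reflexive (cong suc (sym c≡q))) = refl
... | tri> _ c≢q q<c rewrite ≤ᵇ-false c q q<c | ≡ᵇ-false c q c≢q | ≤ᵇ-false (suc c) q (<-trans q<c (n<1+n c)) = refl

∸-suc : ∀ {c n} → c < n → n ∸ c ≡ suc (n ∸ suc c)
∸-suc = +-∸-assoc 1

<+∸⇒< : ∀ n r i → r ≤ i → i < r + (n ∸ r) → i < n
<+∸⇒< n r i r≤i i< with r ≤? n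
... | yes r≤n = subst (i <_) (m+[n∸m]≡n r≤n) i<
... | no r≰n = ⊥-elim (<⇒≱ (subst (i <_) (trans (cong (r +_) (m≤n⇒m∸n≡0 (<⇒≤ (≰⇒> r≰n)))) (+-identityʳ r)) i<) r≤i)

+-suc≡⇒< : ∀ r d n → r + suc d ≡ n → r < n
+-suc≡⇒< r d n e = subst (r <_) e (m<m+n r (s≤s z≤n))

sumFrom : (ℕ → ℕ) → ℕ → ℕ → ℕ
sumFrom g r zero = 0
sumFrom g r (suc d) = g r + sumFrom g (suc r) d

sumFrom-zero : ∀ g r d → (∀ i → r ≤ i → i < r + d → g i ≡ 0) → sumFrom g r d ≡ 0
sumFrom-zero g r zero _ = refl
sumFrom-zero g r (suc d) g≡0 rewrite g≡0 r ≤-refl (m<m+n r (s≤s z≤n)) =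
  sumFrom-zero g (suc r) d (λ i r<i i< → g≡0 i (<⇒≤ r<i) (subst (i <_) (sym (+-suc r d)) i<))

sumFrom-cong : ∀ g₁ g₂ r d → (∀ i → r ≤ i → i < r + d → g₁ i ≡ g₂ i) → sumFrom g₁ r d ≡ sumFrom g₂ r d
sumFrom-cong g₁ g₂ r zero _ = refl
sumFrom-cong g₁ g₂ r (suc d) eq = cong₂ _+_ (eq r ≤-refl (m<m+n r (s≤s z≤n)))
  (sumFrom-cong g₁ g₂ (suc r) d (λ i r<i i< → eq i (<⇒≤ r<i) (subst (i <_) (sym (+-suc r d)) i<)))

sumFrom-+ : ∀ g₁ g₂ r d → sumFrom (λ j → g₁ j + g₂ j) r d ≡ sumFrom g₁ r d + sumFrom g₂ r d
sumFrom-+ g₁ g₂ r zero = refl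
sumFrom-+ g₁ g₂ r (suc d) rewrite sumFrom-+ g₁ g₂ (suc r) d =
  solve 4 (λ a b c e → (a :+ b) :+ (c :+ e) := (a :+ c) :+ (b :+ e)) refl
    (g₁ r) (g₂ r) (sumFrom g₁ (suc r) d) (sumFrom g₂ (suc r) d)

sumFrom-shift : ∀ g r d → sumFrom g (suc r) d ≡ sumFrom (g ∘ suc) r d
sumFrom-shift g r zero = refl
sumFrom-shift g r (suc d) = cong (g (suc r) +_) (sumFrom-shift g (suc r) d)

sumFrom-pos : ∀ g r d m → r ≤ m → m < r + d → 1 ≤ g m → 1 ≤ sumFrom g r d
sumFrom-pos g r zero m r≤m m< _ = ⊥-elim (<⇒≱ m< (subst (_≤ m) (sym (+-identityʳ r)) r≤m))
sumFrom-pos g r (suc d) m r≤m m< 1≤g with m≤n⇒m<n∨m≡n r≤m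
... | inj₂ refl = ≤-trans 1≤g (m≤m+n _ _)
... | inj₁ r<m = ≤-trans (sumFrom-pos g (suc r) d m r<m (subst (m <_) (+-suc r d) m<) 1≤g) (m≤n+m _ _)

boundedSearch : {P : ℕ → Set} → Decidable P → ∀ n → (∃ λ r → r < n × P r) ⊎ (∀ r → r < n → ¬ P r)
boundedSearch P? zero = inj₂ (λ r ())
boundedSearch P? (suc n) with boundedSearch P? n
... | inj₁ (r , r<n , pr) = inj₁ (r , m≤n⇒m≤1+n r<n , pr)
... | inj₂ none with P? n
...   | yes pn = inj₁ (n , ≤-refl , pn)
...   | no ¬pn = inj₂ λ r r<1+n → [ none r , (λ { refl → ¬pn }) ]′ (m<1+n⇒m<n∨m≡n r<1+n)

-- Conservation of paths on the lattice

module Occupancy (n : ℕ) (q : ℕ → ℕ) (q-decreasing : ∀ i j → i < j → j < n → q j < q i) where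

  hits : ℕ → ℕ → ℕ
  hits r c = sumFrom (λ j → bit (c ≡ᵇ q j)) r (n ∸ r)

  hitsRight : ℕ → ℕ → ℕ
  hitsRight r c = sumFrom (λ j → bit (c ≤ᵇ q j)) r (n ∸ r)

  hits-step : ∀ r c → r < n → hits r c ≡ bit (c ≡ᵇ q r) + hits (suc r) c
  hits-step r c r<n rewrite ∸-suc r<n = refl

  hits-beyond : ∀ r c → n ≤ r → hits r c ≡ 0
  hits-beyond r c n≤r rewrite m≤n⇒m∸n≡0 n≤r = refl

  hits-below-own : ∀ r → r < n → hits (suc r) (q r) ≡ 0
  hits-below-own r r<n = sumFrom-zero _ (suc r) (n ∸ suc r) λ i r<i i< →
    cong bit (≡ᵇ-false (q r) (q i) (λ e → <-irrefl (sym e) (q-decreasing r i r<i (<+∸⇒< n (suc r) i r<i i<))))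

  hits≤1 : ∀ r c → hits r c ≤ 1
  hits≤1 r c with r ≤? n
  ... | yes r≤n = bounded (n ∸ r) r (m+[n∸m]≡n r≤n)
    where
    bounded : ∀ d r → r + d ≡ n → hits r c ≤ 1
    bounded zero r e = ≤-trans (≤-reflexive (hits-beyond r c (≤-reflexive (trans (sym e) (+-identityʳ r))))) z≤n
    bounded (suc d) r e with c ℕ.≟ q r
    ... | yes refl rewrite hits-step r c (+-suc≡⇒< r d n e) | ≡ᵇ-true c c refl | hits-below-own r (+-suc≡⇒< r d n e) = s≤s z≤n
    ... | no c≢q rewrite hits-step r c (+-suc≡⇒< r d n e) | ≡ᵇ-false c (q r) c≢q = bounded d (suc r) (trans (sym (+-suc r d)) e)
  ... | no r≰n rewrite hits-beyond r c (<⇒≤ (≰⇒> r≰n)) = z≤n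

  hitsRight-step : ∀ r c → r < n → hitsRight r c ≡ bit (c ≤ᵇ q r) + hitsRight (suc r) c
  hitsRight-step r c r<n rewrite ∸-suc r<n = refl

  hitsRight-end : ∀ c → hitsRight n c ≡ 0
  hitsRight-end c rewrite n∸n≡0 n = refl

  hitsRight-zero : ∀ r c → (∀ j → r ≤ j → j < n → q j < c) → hitsRight r c ≡ 0
  hitsRight-zero r c q<c = sumFrom-zero _ r (n ∸ r) λ i r≤i i< → cong bit (≤ᵇ-false c (q i) (q<c i r≤i (<+∸⇒< n r i r≤i i<)))

  hitsRight-below : ∀ r c → r < n → q r ≤ c → hitsRight (suc r) c ≡ 0
  hitsRight-below r c r<n q≤c = hitsRight-zero (suc r) c (λ j r<j j<n → <-≤-trans (q-decreasing r j r<j j<n) q≤c)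

  hitsRight-split : ∀ r c → hitsRight r c ≡ hits r c + hitsRight r (suc c)
  hitsRight-split r c =
    trans (sumFrom-cong _ _ r (n ∸ r) (λ j _ _ → ≤ᵇ-split c (q j))) (sumFrom-+ _ _ r (n ∸ r))

  hitsRight≤ : ∀ i c → (∀ j → i ≤ j → j < n → q j < c) → hitsRight 0 c ≤ i
  hitsRight≤ i c q<c = bounded n 0 refl
    where
    bounded : ∀ d r → r + d ≡ n → hitsRight r c ≤ i ∸ r
    bounded zero r e rewrite +-identityʳ r | e | hitsRight-end c = z≤n
    bounded (suc d) r e rewrite hitsRight-step r c (+-suc≡⇒< r d n e) with r <? i
    ... | yes r<i rewrite ∸-suc r<i = +-mono-≤ (bit≤1 _) (bounded d (suc r) (trans (sym (+-suc r d)) e))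
    ... | no r≮i rewrite ≤ᵇ-false c (q r) (q<c r (≮⇒≥ r≮i) (+-suc≡⇒< r d n e)) =
      ≤-trans (bounded d (suc r) (trans (sym (+-suc r d)) e)) (∸-monoʳ-≤ i (n≤1+n r))

-- vb r c and hb r c mark the vertical edge above row r in column c and the horizontal edge
-- west of column c in row r as used by up-right paths; balance says that every vertex is
-- entered from the west or south as often as it is left to the east or north.
module Lattice (n N : ℕ) (vb hb : ℕ → ℕ → Bool) (q : ℕ → ℕ)
  (q-decreasing : ∀ i j → i < j → j < n → q j < q i)
  (balance : ∀ r c → r < n → c < N → bit (hb r c) + bit (vb (suc r) c) ≡ bit (hb r (suc c)) + bit (vb r c))
  (east : ∀ r → r < n → hb r N ≡ false)
  (south : ∀ c → vb n c ≡ false) where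

  open Occupancy n q q-decreasing

  crossings : ℕ → ℕ → ℕ
  crossings r c = sumFrom (bit ∘ vb r) c (N ∸ c)

  ZeroVertex : ℕ → Set
  ZeroVertex r = q r < N × vb r (q r) ≡ false × vb (suc r) (q r) ≡ false × hb r (q r) ≡ true

  zeroVertex? : Decidable ZeroVertex
  zeroVertex? r = q r <? N ×-dec vb r (q r) Bool.≟ false ×-dec vb (suc r) (q r) Bool.≟ false ×-dec hb r (q r) Bool.≟ true

  flux : ∀ r → r < n → ∀ c → c ≤ N → crossings r c ≡ crossings (suc r) c + bit (hb r c)
  flux r r<n c c≤N = go (N ∸ c) c (m+[n∸m]≡n c≤N)
    where
    go : ∀ d c → c + d ≡ N → sumFrom (bit ∘ vb r) c d ≡ sumFrom (bit ∘ vb (suc r)) c d + bit (hb r c)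
    go zero c e rewrite +-identityʳ c | e | east r r<n = refl
    go (suc d) c e = begin
      bit (vb r c) + sumFrom (bit ∘ vb r) (suc c) d
        ≡⟨ cong (bit (vb r c) +_) (go d (suc c) (trans (sym (+-suc c d)) e)) ⟩
      bit (vb r c) + (S + h′)
        ≡⟨ solve 3 (λ v S h′ → v :+ (S :+ h′) := S :+ (h′ :+ v)) refl (bit (vb r c)) S h′ ⟩
      S + (h′ + bit (vb r c))
        ≡⟨ cong (S +_) (sym (balance r c r<n (subst (c <_) e (m<m+n c (s≤s z≤n))))) ⟩
      S + (bit (hb r c) + bit (vb (suc r) c))
        ≡⟨ solve 3 (λ S h v → S :+ (h :+ v) := (v :+ S) :+ h) refl S (bit (hb r c)) (bit (vb (suc r) c)) ⟩
      (bit (vb (suc r) c) + S) + bit (hb r c) ∎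
      where
      open ≡-Reasoning
      S = sumFrom (bit ∘ vb (suc r)) (suc c) d
      h′ = bit (hb r (suc c))

  crossings-step : ∀ r c → c < N → crossings r c ≡ bit (vb r c) + crossings r (suc c)
  crossings-step r c c<N rewrite ∸-suc c<N = refl

  crossings-beyond : ∀ r c → N ≤ c → crossings r c ≡ 0
  crossings-beyond r c N≤c rewrite m≤n⇒m∸n≡0 N≤c = refl

  crossings-south : ∀ c → crossings n c ≡ 0
  crossings-south c = sumFrom-zero _ c (N ∸ c) (λ i _ _ → cong bit (south i))

  crossings-antitone : ∀ r c c′ → c ≤ c′ → crossings r c′ ≤ crossings r c
  crossings-antitone r c c′ c≤c′ = subst (λ x → crossings r x ≤ crossings r c) (m∸n+n≡m c≤c′) (shifted (c′ ∸ c))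
    where
    step : ∀ c → crossings r (suc c) ≤ crossings r c
    step c with c <? N
    ... | yes c<N rewrite crossings-step r c c<N = m≤n+m _ _
    ... | no c≮N rewrite crossings-beyond r (suc c) (m≤n⇒m≤1+n (≮⇒≥ c≮N)) = z≤n
    shifted : ∀ d → crossings r (d + c) ≤ crossings r c
    shifted zero = ≤-refl
    shifted (suc d) = ≤-trans (step (d + c)) (shifted d)

  -- A path leaving row r upwards right of q r, when none enters it from below at or right of
  -- q r, must have entered through the west edge of the vertex (r, q r).
  zeroVertex-from-excess : ∀ r c → r < n → (∀ c → crossings (suc r) c ≤ hitsRight (suc r) c) →
    q r < c → 1 ≤ crossings r c → ZeroVertex r
  zeroVertex-from-excess r c r<n below q<c 1≤cr =
    Q<N , bit≡0⇒false _ v≡0 , bit≡0⇒false _ v′≡0 , 1≤bit⇒true _ (subst (1 ≤_) turn (≤-trans 1≤rest (m≤n+m _ _)))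
    where
    Q = q r
    c<N : c < N
    c<N with c <? N
    ... | yes c<N = c<N
    ... | no c≮N = ⊥-elim (<⇒≱ 1≤cr (≤-reflexive (crossings-beyond r c (≮⇒≥ c≮N))))
    Q<N : Q < N
    Q<N = <-trans q<c c<N
    noneBelow : ∀ c → Q ≤ c → crossings (suc r) c ≡ 0
    noneBelow c Q≤c = n≤0⇒n≡0 (subst (crossings (suc r) c ≤_) (hitsRight-below r c r<n Q≤c) (below c))
    1≤rest : 1 ≤ crossings r (suc Q)
    1≤rest = ≤-trans 1≤cr (crossings-antitone r (suc Q) c q<c)
    turn : bit (vb r Q) + crossings r (suc Q) ≡ bit (hb r Q)
    turn = trans (sym (crossings-step r Q Q<N)) (trans (flux r r<n Q (<⇒≤ Q<N)) (cong (_+ bit (hb r Q)) (noneBelow Q ≤-refl)))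
    v≡0 : bit (vb r Q) ≡ 0
    v≡0 = n≤0⇒n≡0 (+-cancelʳ-≤ (crossings r (suc Q)) _ 0 (≤-trans (≤-reflexive turn) (≤-trans (bit≤1 _) 1≤rest)))
    v′≡0 : bit (vb (suc r) Q) ≡ 0
    v′≡0 = m+n≡0⇒m≡0 (bit (vb (suc r) Q)) (trans (sym (crossings-step (suc r) Q Q<N)) (noneBelow Q ≤-refl))

  crossings≤hitsRight : (∀ r → r < n → ¬ ZeroVertex r) → ∀ r → r ≤ n → ∀ c → crossings r c ≤ hitsRight r c
  crossings≤hitsRight noZero r r≤n = fromBelow (n ∸ r) r (m+[n∸m]≡n r≤n)
    where
    stepUp : ∀ r → r < n → (∀ c → crossings (suc r) c ≤ hitsRight (suc r) c) → ∀ c → crossings r c ≤ hitsRight r c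
    stepUp r r<n below c with c ≤? q r | c ≤? N
    ... | yes c≤q | yes c≤N rewrite flux r r<n c c≤N | hitsRight-step r c r<n | ≤ᵇ-true c (q r) c≤q =
      subst (_≤ suc (hitsRight (suc r) c)) (+-comm (bit (hb r c)) _) (+-mono-≤ (bit≤1 (hb r c)) (below c))
    ... | yes _ | no c≰N rewrite crossings-beyond r c (<⇒≤ (≰⇒> c≰N)) = z≤n
    ... | no c≰q | _ with crossings r c in eq
    ...   | zero = z≤n
    ...   | suc _ = ⊥-elim (noZero r r<n (zeroVertex-from-excess r c r<n below (≰⇒> c≰q) (subst (1 ≤_) (sym eq) (s≤s z≤n))))
    fromBelow : ∀ d r → r + d ≡ n → ∀ c → crossings r c ≤ hitsRight r c
    fromBelow zero r e c rewrite +-identityʳ r | e | crossings-south c = z≤n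
    fromBelow (suc d) r e = stepUp r (+-suc≡⇒< r d n e) (fromBelow d (suc r) (trans (sym (+-suc r d)) e))

  -- Paths leaving through the top in columns p 0 > ⋯ > p i cross the top line i + 1 times at
  -- or right of p i; without zero vertices only q 0, …, q (i − 1) can lie there if q i < p i.
  noZeroVertex⇒dominated : (p : ℕ → ℕ) → (∀ i j → i < j → j < n → p j < p i) → (∀ k → k < n → p k < N) →
    (∀ k → k < n → vb 0 (p k) ≡ true) → (∀ r → r < n → ¬ ZeroVertex r) → ∀ i → i < n → p i ≤ q i
  noZeroVertex⇒dominated p p-decreasing p<N top noZero i i<n = ≮⇒≥ λ q<p →
    <⇒≱ (topCrossings i i<n) (≤-trans (crossings≤hitsRight noZero 0 z≤n (p i)) (hitsRight≤ i (p i) (targets q<p)))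
    where
    topCrossings : ∀ i → i < n → suc i ≤ crossings 0 (p i)
    topCrossings zero i<n rewrite crossings-step 0 (p 0) (p<N 0 i<n) | top 0 i<n = s≤s z≤n
    topCrossings (suc i) i<n rewrite crossings-step 0 (p (suc i)) (p<N (suc i) i<n) | top (suc i) i<n =
      s≤s (≤-trans (topCrossings i (<-trans (n<1+n i) i<n))
                   (crossings-antitone 0 (suc (p (suc i))) (p i) (p-decreasing i (suc i) (n<1+n i) i<n)))
    targets : q i < p i → ∀ j → i ≤ j → j < n → q j < p i
    targets q<p j i≤j j<n with m≤n⇒m<n∨m≡n i≤j
    ... | inj₁ i<j = <-trans (q-decreasing i j i<j j<n) q<p
    ... | inj₂ refl = q<p

  module Determined (q<N : ∀ j → j < n → q j < N) (top : ∀ c → c < N → bit (vb 0 c) ≡ hits 0 c)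
                    (noZero : ∀ r → r < n → ¬ ZeroVertex r) where

    hitsRight-beyond : ∀ r c → N ≤ c → hitsRight r c ≡ 0
    hitsRight-beyond r c N≤c = hitsRight-zero r c (λ j _ j<n → <-≤-trans (q<N j j<n) N≤c)

    crossings≡hitsRight-top : ∀ d c → N ≤ c + d → crossings 0 c ≡ hitsRight 0 c
    crossings≡hitsRight-top zero c N≤c rewrite +-identityʳ c | crossings-beyond 0 c N≤c | hitsRight-beyond 0 c N≤c = refl
    crossings≡hitsRight-top (suc d) c N≤ with c <? N
    ... | yes c<N rewrite crossings-step 0 c c<N | top c c<N | hitsRight-split 0 c
                        | crossings≡hitsRight-top d (suc c) (subst (N ≤_) (+-suc c d) N≤) = refl
    ... | no c≮N rewrite crossings-beyond 0 c (≮⇒≥ c≮N) | hitsRight-beyond 0 c (≮⇒≥ c≮N) = refl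

    -- Equality propagates downwards: the upper bound is crossings≤hitsRight, the lower one
    -- follows from flux since each hb is at most one.
    crossings≡hitsRight : ∀ r → r ≤ n → ∀ c → crossings r c ≡ hitsRight r c
    crossings≡hitsRight zero _ c = crossings≡hitsRight-top N c (m≤n+m N c)
    crossings≡hitsRight (suc r) r<n c = ≤-antisym (crossings≤hitsRight noZero (suc r) r<n c) lower
      where
      lower : hitsRight (suc r) c ≤ crossings (suc r) c
      lower with c ≤? N | c ≤? q r
      ... | no c≰N | _ rewrite hitsRight-beyond (suc r) c (<⇒≤ (≰⇒> c≰N)) = z≤n
      ... | yes _ | no c≰q rewrite hitsRight-below r c r<n (<⇒≤ (≰⇒> c≰q)) = z≤n
      ... | yes c≤N | yes c≤q = +-cancelʳ-≤ 1 _ _ (begin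
        hitsRight (suc r) c + 1          ≡⟨ +-comm _ 1 ⟩
        1 + hitsRight (suc r) c          ≡⟨ cong (_+ hitsRight (suc r) c) (cong bit (sym (≤ᵇ-true c (q r) c≤q))) ⟩
        bit (c ≤ᵇ q r) + hitsRight (suc r) c ≡⟨ sym (hitsRight-step r c r<n) ⟩
        hitsRight r c                    ≡⟨ sym (crossings≡hitsRight r (<⇒≤ r<n) c) ⟩
        crossings r c                    ≡⟨ flux r r<n c c≤N ⟩
        crossings (suc r) c + bit (hb r c) ≤⟨ +-monoʳ-≤ (crossings (suc r) c) (bit≤1 (hb r c)) ⟩
        crossings (suc r) c + 1          ∎)
        where open ≤-Reasoning

    hb-determined : ∀ r c → r < n → c ≤ N → hb r c ≡ (c ≤ᵇ q r)
    hb-determined r c r<n c≤N = bit-injective _ _ (+-cancelˡ-≡ (hitsRight (suc r) c) _ _ (begin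
      hitsRight (suc r) c + bit (hb r c) ≡⟨ cong (_+ bit (hb r c)) (sym (crossings≡hitsRight (suc r) r<n c)) ⟩
      crossings (suc r) c + bit (hb r c) ≡⟨ sym (flux r r<n c c≤N) ⟩
      crossings r c                      ≡⟨ crossings≡hitsRight r (<⇒≤ r<n) c ⟩
      hitsRight r c                      ≡⟨ hitsRight-step r c r<n ⟩
      bit (c ≤ᵇ q r) + hitsRight (suc r) c ≡⟨ +-comm _ (hitsRight (suc r) c) ⟩
      hitsRight (suc r) c + bit (c ≤ᵇ q r) ∎))
      where open ≡-Reasoning

    vb-determined : ∀ r c → r ≤ n → c < N → bit (vb r c) ≡ hits r c
    vb-determined r c r≤n c<N = +-cancelʳ-≡ (crossings r (suc c)) _ _ (begin
      bit (vb r c) + crossings r (suc c) ≡⟨ sym (crossings-step r c c<N) ⟩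
      crossings r c                      ≡⟨ crossings≡hitsRight r r≤n c ⟩
      hitsRight r c                      ≡⟨ hitsRight-split r c ⟩
      hits r c + hitsRight r (suc c)     ≡⟨ cong (hits r c +_) (sym (crossings≡hitsRight r r≤n (suc c))) ⟩
      hits r c + crossings r (suc c)     ∎)
      where open ≡-Reasoning

extend : {m : ℕ} → (Fin m → A) → A → ℕ → A
extend {m = zero} f d i = d
extend {m = suc m} f d zero = f zero
extend {m = suc m} f d (suc i) = extend (f ∘ suc) d i

extend-toℕ : {m : ℕ} (f : Fin m → A) (d : A) (i : Fin m) → extend f d (toℕ i) ≡ f i
extend-toℕ f d zero = refl
extend-toℕ f d (suc i) = extend-toℕ (f ∘ suc) d i

extend-beyond : ∀ m (f : Fin m → A) d i → m ≤ i → extend f d i ≡ d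
extend-beyond zero f d i _ = refl
extend-beyond (suc m) f d (suc i) (s≤s m≤i) = extend-beyond m (f ∘ suc) d i m≤i

extend-< : {m : ℕ} (f : Fin m → A) (d : A) (i : ℕ) (i<m : i < m) → extend f d i ≡ f (fromℕ< i<m)
extend-< f d i i<m = trans (cong (extend f d) (sym (toℕ-fromℕ< i<m))) (extend-toℕ f d (fromℕ< i<m))

∧-trueˡ : ∀ {a b} → a ∧ b ≡ true → a ≡ true
∧-trueˡ {true} _ = refl

∧-trueʳ : ∀ a {b} → a ∧ b ≡ true → b ≡ true
∧-trueʳ true e = e

∧-intro : ∀ {a b} → a ≡ true → b ≡ true → a ∧ b ≡ true
∧-intro refl refl = refl

allB-elim : ∀ {m} (f : Fin m → Bool) → allB f ≡ true → ∀ i → f i ≡ true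
allB-elim f = go id
  where
  go : ∀ {k} (g : Fin k → _) → BLA.and (List.map f (tabulate g)) ≡ true → ∀ i → f (g i) ≡ true
  go g all zero = ∧-trueˡ all
  go g all (suc i) = go (g ∘ suc) (∧-trueʳ (f (g zero)) all) i

allB-intro : ∀ {m} (f : Fin m → Bool) → (∀ i → f i ≡ true) → allB f ≡ true
allB-intro f = go id
  where
  go : ∀ {k} (g : Fin k → _) → (∀ i → f (g i) ≡ true) → BLA.and (List.map f (tabulate g)) ≡ true
  go {zero} g _ = refl
  go {suc k} g all rewrite all zero = go (g ∘ suc) (all ∘ suc)

anyB-intro : ∀ {m} (f : Fin m → Bool) i → f i ≡ true → BLA.any f (List.allFin m) ≡ true
anyB-intro f = go id
  where
  go : ∀ {k} (g : Fin k → _) i → f (g i) ≡ true → BLA.or (List.map f (tabulate g)) ≡ true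
  go g zero e rewrite e = refl
  go g (suc i) e with f (g zero)
  ... | true = refl
  ... | false = go (g ∘ suc) i e

allB-cong : ∀ {m} {f g : Fin m → Bool} → (∀ i → f i ≡ g i) → allB f ≡ allB g
allB-cong {m} f≗g = cong BLA.and (List.map-cong f≗g (List.allFin m))

boolEq-elim : ∀ a b → boolEq a b ≡ true → a ≡ b
boolEq-elim true true _ = refl
boolEq-elim false false _ = refl

boolEq-refl : ∀ a → boolEq a a ≡ true
boolEq-refl true = refl
boolEq-refl false = refl

iceRule⇒balance : ∀ w e nn ss → (count (not w ∷ e ∷ not nn ∷ ss ∷ []) ≡ᵇ 2) ≡ true →
  bit (not w) + bit ss ≡ bit (not e) + bit nn
iceRule⇒balance true true true true _ = refl
iceRule⇒balance true true true false ()
iceRule⇒balance true true false true ()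
iceRule⇒balance true true false false _ = refl
iceRule⇒balance true false true true ()
iceRule⇒balance true false true false ()
iceRule⇒balance true false false true _ = refl
iceRule⇒balance true false false false ()
iceRule⇒balance false true true true ()
iceRule⇒balance false true true false _ = refl
iceRule⇒balance false true false true ()
iceRule⇒balance false true false false ()
iceRule⇒balance false false true true _ = refl
iceRule⇒balance false false true false ()
iceRule⇒balance false false false true ()
iceRule⇒balance false false false false _ = refl

balance⇒iceRule : ∀ w e nn ss → bit (not w) + bit ss ≡ bit (not e) + bit nn →
  (count (not w ∷ e ∷ not nn ∷ ss ∷ []) ≡ᵇ 2) ≡ true
balance⇒iceRule true true true true _ = refl
balance⇒iceRule true true true false ()
balance⇒iceRule true true false true ()
balance⇒iceRule true true false false _ = refl
balance⇒iceRule true false true true ()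
balance⇒iceRule true false true false ()
balance⇒iceRule true false false true _ = refl
balance⇒iceRule true false false false ()
balance⇒iceRule false true true true ()
balance⇒iceRule false true true false _ = refl
balance⇒iceRule false true false true ()
balance⇒iceRule false true false false ()
balance⇒iceRule false false true true _ = refl
balance⇒iceRule false false true false ()
balance⇒iceRule false false false true ()
balance⇒iceRule false false false false _ = refl

bit-1≤ᵇ : ∀ {e} → e ≤ 1 → bit (1 ≤ᵇ e) ≡ e
bit-1≤ᵇ {zero} _ = refl
bit-1≤ᵇ {suc zero} _ = refl
bit-1≤ᵇ {suc (suc e)} (s≤s ())

bit-or-tabulate : ∀ m (h : Fin m → Bool) → sumFrom (bit ∘ extend h false) 0 m ≤ 1 →
  bit (BLA.or (tabulate h)) ≡ sumFrom (bit ∘ extend h false) 0 m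
bit-or-tabulate zero h _ = refl
bit-or-tabulate (suc m) h ≤1 with h zero
... | false = trans (bit-or-tabulate m (h ∘ suc) (subst (_≤ 1) (sumFrom-shift _ 0 m) ≤1)) (sym (sumFrom-shift _ 0 m))
... | true = cong suc (sym (n≤0⇒n≡0 (≤-pred ≤1)))

-- hb r k: the hydrogen of horizontal edge k in row r is bonded to its east endpoint;
-- vb k c: the hydrogen of vertical edge k in column c is bonded to its north endpoint.
-- Both are false outside the grid.
module Arrays {n N : ℕ} (s : State n N) where

  vb : ℕ → ℕ → Bool
  vb k c = extend (λ k′ → extend (V s k′) false c) false k

  hb : ℕ → ℕ → Bool
  hb r k = extend (λ r′ → not (extend (H s r′) true k)) false r

  vb-toℕ : ∀ k c → vb (toℕ k) (toℕ c) ≡ V s k c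
  vb-toℕ k c = trans (extend-toℕ (λ k′ → extend (V s k′) false (toℕ c)) false k) (extend-toℕ (V s k) false c)

  hb-toℕ : ∀ r k → hb (toℕ r) (toℕ k) ≡ not (H s r k)
  hb-toℕ r k = trans (extend-toℕ (λ r′ → not (extend (H s r′) true (toℕ k))) false r)
                     (cong not (extend-toℕ (H s r) true k))

  module Valid (p : Fin n → ℕ) (valid : validState p s ≡ true) where

    private
      boundary : boundaryOK p s ≡ true
      boundary = ∧-trueʳ (allB (λ r → allB (vertexOK s r))) valid
      eastSouthNorth = ∧-trueʳ (allB (λ r → not (H s r zero))) boundary
      southNorth = ∧-trueʳ (allB (λ r → H s r (fromℕ N))) eastSouthNorth
      eastBC : ∀ r → H s r (fromℕ N) ≡ true
      eastBC = allB-elim (λ r → H s r (fromℕ N)) (∧-trueˡ eastSouthNorth)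
      southBC : ∀ c → not (V s (fromℕ n) c) ≡ true
      southBC = allB-elim (λ c → not (V s (fromℕ n) c)) (∧-trueˡ southNorth)
      northBC : ∀ c → boolEq (not (V s zero c)) (not (inPartCols p (suc (toℕ c)))) ≡ true
      northBC = allB-elim (λ c → boolEq (not (V s zero c)) (not (inPartCols p (suc (toℕ c)))))
                          (∧-trueʳ (allB (λ c → not (V s (fromℕ n) c))) southNorth)

    balance : ∀ r c → r < n → c < N → bit (hb r c) + bit (vb (suc r) c) ≡ bit (hb r (suc c)) + bit (vb r c)
    balance r c r<n c<N = subst₂ (λ r c → bit (hb r c) + bit (vb (suc r) c) ≡ bit (hb r (suc c)) + bit (vb r c))
      (toℕ-fromℕ< r<n) (toℕ-fromℕ< c<N) (atVertex (fromℕ< r<n) (fromℕ< c<N))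
      where
      atVertex : ∀ r c → bit (hb (toℕ r) (toℕ c)) + bit (vb (suc (toℕ r)) (toℕ c))
                       ≡ bit (hb (toℕ r) (suc (toℕ c))) + bit (vb (toℕ r) (toℕ c))
      atVertex r c = begin
        bit (hb (toℕ r) (toℕ c)) + bit (vb (suc (toℕ r)) (toℕ c))
          ≡⟨ cong₂ (λ x y → bit x + bit y)
               (trans (cong (hb (toℕ r)) (sym (toℕ-inject₁ c))) (hb-toℕ r (inject₁ c))) (vb-toℕ (suc r) c) ⟩
        bit (not (H s r (inject₁ c))) + bit (V s (suc r) c)
          ≡⟨ iceRule⇒balance (H s r (inject₁ c)) (H s r (suc c)) (V s (inject₁ r) c) (V s (suc r) c)
               (allB-elim (vertexOK s r) (allB-elim (λ r → allB (vertexOK s r)) (∧-trueˡ valid) r) c) ⟩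
        bit (not (H s r (suc c))) + bit (V s (inject₁ r) c)
          ≡⟨ sym (cong₂ (λ x y → bit x + bit y) (hb-toℕ r (suc c))
               (trans (cong (λ k → vb k (toℕ c)) (sym (toℕ-inject₁ r))) (vb-toℕ (inject₁ r) c))) ⟩
        bit (hb (toℕ r) (suc (toℕ c))) + bit (vb (toℕ r) (toℕ c)) ∎
        where open ≡-Reasoning

    east : ∀ r → r < n → hb r N ≡ false
    east r r<n = subst₂ (λ r c → hb r c ≡ false) (toℕ-fromℕ< r<n) (toℕ-fromℕ N)
      (trans (hb-toℕ (fromℕ< r<n) (fromℕ N)) (cong not (eastBC _)))

    south : ∀ c → vb n c ≡ false
    south c with c <? N
    ... | yes c<N = subst₂ (λ k c → vb k c ≡ false) (toℕ-fromℕ n) (toℕ-fromℕ< c<N)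
      (trans (vb-toℕ (fromℕ n) (fromℕ< c<N))
             (trans (sym (not-involutive _)) (cong not (southBC _))))
    ... | no c≮N = trans (cong (λ k → vb k c) (sym (toℕ-fromℕ n)))
      (trans (extend-toℕ (λ k′ → extend (V s k′) false c) false (fromℕ n))
             (extend-beyond N (V s (fromℕ n)) false c (≮⇒≥ c≮N)))

    north : ∀ c → c < N → vb 0 c ≡ inPartCols p (suc c)
    north c c<N = subst (λ c → vb 0 c ≡ inPartCols p (suc c)) (toℕ-fromℕ< c<N)
      (trans (vb-toℕ zero (fromℕ< c<N))
             (trans (sym (not-involutive _))
                    (trans (cong not (boolEq-elim _ _ (northBC _)))
                           (not-involutive _))))

sameState⇒validState≡ : ∀ {n N} {z y : State n N} → SameState z y → ∀ p → validState p z ≡ validState p y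
sameState⇒validState≡ {n} {N} (h , v) p =
  cong₂ _∧_ (allB-cong λ r → allB-cong λ c →
              cong₂ (λ (w , e) (nn , ss) → count (not w ∷ e ∷ not nn ∷ ss ∷ []) ≡ᵇ 2)
                    (cong₂ _,_ (h r (inject₁ c)) (h r (suc c))) (cong₂ _,_ (v (inject₁ r) c) (v (suc r) c)))
  (cong₂ _∧_ (allB-cong λ r → cong not (h r zero))
  (cong₂ _∧_ (allB-cong λ r → h r (fromℕ N))
  (cong₂ _∧_ (allB-cong λ c → cong not (v (fromℕ n) c))
             (allB-cong λ c → cong (λ b → boolEq (not b) (not (inPartCols p (suc (toℕ c))))) (v zero c)))))

sameState⇒stateWeight≡ : ∀ {n N} {z y : State n N} → SameState z y → ∀ x a → stateWeight x a z ≡ stateWeight x a y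
sameState⇒stateWeight≡ {n} {N} (h , v) x a =
  cong prodQ (List.map-cong (λ r → cong prodQ (List.map-cong (λ c →
    cong₂ (λ (nn , ss) w → if nn ∧ ss then divQ (x r) (a (suc (toℕ c)))
                           else if nn ∧ w then divQ (x r) (a (suc (toℕ c))) ℚ.- 1ℚ else 1ℚ)
          (cong₂ _,_ (cong not (v (inject₁ r) c)) (v (suc r) c)) (cong not (h r (inject₁ c))))
    (List.allFin N))) (List.allFin n))

module Partition (n : ℕ) (la : Fin n → ℕ) (isPartition : IsPartition la) where

  part : ℕ → ℕ
  part = extend la 0

  -- 0-indexed column of the top exit λ_{j+1} + n − j
  column : ℕ → ℕ
  column j = part j + (n ∸ suc j)

  part-antitone : ∀ i j → i ≤ j → j < n → part j ≤ part i
  part-antitone i j i≤j j<n = subst₂ _≤_ (sym (extend-< la 0 j j<n)) (sym (extend-< la 0 i i<n))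
    (isPartition (fromℕ< i<n) (fromℕ< j<n) (subst₂ _≤_ (sym (toℕ-fromℕ< _)) (sym (toℕ-fromℕ< _)) i≤j))
    where i<n = ≤-<-trans i≤j j<n

  column-decreasing : ∀ i j → i < j → j < n → column j < column i
  column-decreasing i j i<j j<n = +-mono-≤-< (part-antitone i j (<⇒≤ i<j) j<n) (∸-monoʳ-< (s≤s i<j) j<n)

  suc-column : ∀ (r : Fin n) → suc (column (toℕ r)) ≡ la r + (n ∸ toℕ r)
  suc-column r = begin
    suc (part (toℕ r) + (n ∸ suc (toℕ r))) ≡⟨ sym (+-suc _ _) ⟩
    part (toℕ r) + suc (n ∸ suc (toℕ r))   ≡⟨ cong₂ _+_ (extend-toℕ la 0 r) (sym (∸-suc (toℕ<n r))) ⟩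
    la r + (n ∸ toℕ r)                      ∎
    where open ≡-Reasoning

  column<n+part0 : ∀ j → j < n → column j < n + part 0
  column<n+part0 j j<n = subst (column j <_) (+-comm (part 0) n)
    (+-mono-≤-< (part-antitone 0 j z≤n j<n) (∸-monoʳ-< {n} {suc j} {0} (s≤s z≤n) j<n))

firstPart≡part0 : ∀ n (la : Fin n → ℕ) → 1 ≤ n → firstPart la ≡ extend la 0 0
firstPart≡part0 (suc n) la _ = refl

prodQ-tabulate-zero : {m : ℕ} (f : A → ℚ) (g : Fin m → A) (i : Fin m) → f (g i) ≡ 0ℚ → prodQ (List.map f (tabulate g)) ≡ 0ℚ
prodQ-tabulate-zero f g zero e rewrite e = ℚP.*-zeroˡ (prodQ (List.map f (tabulate (g ∘ suc))))
prodQ-tabulate-zero f g (suc i) e rewrite prodQ-tabulate-zero f (g ∘ suc) i e = ℚP.*-zeroʳ (f (g zero))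

divQ-self : ∀ p → p ≢ 0ℚ → divQ p p ≡ 1ℚ
divQ-self p p≢0 with p ℚ.≟ 0ℚ
... | yes p≡0 = ⊥-elim (p≢0 p≡0)
... | no p≢0′ = ℚP.*-inverseʳ p {{ℚ.≢-nonZero p≢0′}}

-- At a vertex of row r in column (a_μ)_r with hydrogens bonded north and west, the weight
-- (a_μ)_r / a_c − 1 vanishes.
zeroVertex⇒stateWeight≡0 : ∀ {n N} (s : State n N) (a : ℕ → ℚ) → (∀ c → a c ≢ 0ℚ) →
  (mu : Fin n → ℕ) (isPartition : IsPartition mu) →
  let open Arrays s; open Partition n mu isPartition in
  ∀ r → r < n → column r < N → vb r (column r) ≡ false → vb (suc r) (column r) ≡ false → hb r (column r) ≡ true →
  stateWeight (aSub a mu) a s ≡ 0ℚ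
zeroVertex⇒stateWeight≡0 {n} {N} s a a≢0 mu isPartition r r<n col<N north-open south-open west-bonded =
  prodQ-tabulate-zero _ id r′ (prodQ-tabulate-zero _ id c′ weight≡0)
  where
  open Arrays s
  open Partition n mu isPartition
  r′ = fromℕ< r<n
  c′ = fromℕ< col<N
  r≡ : toℕ r′ ≡ r
  r≡ = toℕ-fromℕ< r<n
  c≡ : toℕ c′ ≡ column r
  c≡ = toℕ-fromℕ< col<N
  north-free : V s (inject₁ r′) c′ ≡ false
  north-free = trans (sym (vb-toℕ (inject₁ r′) c′))
             (subst₂ (λ x y → vb x y ≡ false) (sym (trans (toℕ-inject₁ r′) r≡)) (sym c≡) north-open)
  south-free : V s (suc r′) c′ ≡ false
  south-free = trans (sym (vb-toℕ (suc r′) c′)) (subst₂ (λ x y → vb x y ≡ false) (sym (cong suc r≡)) (sym c≡) south-open)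
  west-bound : not (H s r′ (inject₁ c′)) ≡ true
  west-bound = trans (sym (hb-toℕ r′ (inject₁ c′)))
             (subst₂ (λ x y → hb x y ≡ true) (sym r≡) (sym (trans (toℕ-inject₁ c′) c≡)) west-bonded)
  ratio≡1 : divQ (aSub a mu r′) (a (suc (toℕ c′))) ≡ 1ℚ
  ratio≡1 = trans (cong (λ k → divQ (aSub a mu r′) (a k)) (trans (cong suc (trans c≡ (cong column (sym r≡)))) (suc-column r′)))
                  (divQ-self _ (a≢0 _))
  weight≡0 : vertexWeight (aSub a mu) a s r′ c′ ≡ 0ℚ
  weight≡0 rewrite north-free | south-free | west-bound | ratio≡1 = ℚP.+-inverseʳ 1ℚ

IsThreshold : ℕ → (ℕ → Set) → ℕ → Set
IsThreshold m P t = t ≤ m × (∀ k → k < m → (P k → k < t) × (k < t → P k))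

threshold : {P : ℕ → Set} → Decidable P → (∀ k k′ → k′ ≤ k → P k → P k′) → ∀ m → ∃ (IsThreshold m P)
threshold P? closed zero = 0 , z≤n , λ k ()
threshold {P} P? closed (suc m) with threshold P? closed m
... | t , t≤m , thr with m≤n⇒m<n∨m≡n t≤m
...   | inj₁ t<m = t , m≤n⇒m≤1+n t≤m , extendedBy λ k≡m →
          (λ pm → ⊥-elim (<-irrefl refl (proj₁ (thr t t<m) (closed m t t≤m (subst P k≡m pm)))))
        , (λ m<t → ⊥-elim (<⇒≱ (subst (_< t) k≡m m<t) (<⇒≤ t<m)))
  where
  extendedBy : (∀ {k} → k ≡ m → (P k → k < t) × (k < t → P k)) → ∀ k → k < suc m → (P k → k < t) × (k < t → P k)
  extendedBy last k k<1+m = [ thr k , last ]′ (m<1+n⇒m<n∨m≡n k<1+m)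
...   | inj₂ refl with P? t
...     | yes pt = suc t , ≤-refl , λ k k<1+t → (λ _ → k<1+t) , (λ _ → closed t k (≤-pred k<1+t) pt)
...     | no ¬pt = t , n≤1+n t , λ k k<1+t →
          [ thr k , (λ { refl → (λ pt → ⊥-elim (¬pt pt)) , (λ t<t → ⊥-elim (<-irrefl refl t<t)) }) ]′ (m<1+n⇒m<n∨m≡n k<1+t)

threshold-mono : ∀ {m P Q t t′} → (∀ {k} → P k → Q k) → IsThreshold m P t → IsThreshold m Q t′ → t ≤ t′
threshold-mono {t = t} {t′} P⇒Q (t≤m , thrP) (_ , thrQ) = ≮⇒≥ λ t′<t →
  <-irrefl refl (proj₁ (thrQ t′ (<-≤-trans t′<t t≤m)) (P⇒Q (proj₂ (thrP t′ (<-≤-trans t′<t t≤m)) t′<t)))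

threshold-unique : ∀ {m P t t′} → IsThreshold m P t → IsThreshold m P t′ → t ≡ t′
threshold-unique thr thr′ = ≤-antisym (threshold-mono id thr thr′) (threshold-mono id thr′ thr)

length-filter-prefix : {P : A → Set} (P? : Decidable P) (m : ℕ) (g : Fin m → A) (t : ℕ) → t ≤ m →
  (∀ (k : Fin m) → (P (g k) → toℕ k < t) × (toℕ k < t → P (g k))) → List.length (List.filter P? (tabulate g)) ≡ t
length-filter-prefix P? zero g .zero z≤n _ = refl
length-filter-prefix P? (suc m) g t t≤ thr with P? (g zero) | t
... | yes p | zero = ⊥-elim (<⇒≱ (proj₁ (thr zero) p) z≤n)
... | yes p | suc t′ = cong suc (length-filter-prefix P? m (g ∘ suc) t′ (≤-pred t≤)
      λ k → (λ pk → ≤-pred (proj₁ (thr (suc k)) pk)) , (λ k<t′ → proj₂ (thr (suc k)) (s≤s k<t′)))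
... | no _ | zero = length-filter-prefix P? m (g ∘ suc) 0 z≤n
      λ k → (λ pk → ⊥-elim (<⇒≱ (proj₁ (thr (suc k)) pk) z≤n)) , (λ ())
... | no ¬p | suc t′ = ⊥-elim (¬p (proj₂ (thr zero) (s≤s z≤n)))

filterᵇ : (ℕ → Bool) → List ℕ → List ℕ
filterᵇ P [] = []
filterᵇ P (x ∷ xs) = if P x then x ∷ filterᵇ P xs else filterᵇ P xs

filterᵇ-++ : ∀ P xs ys → filterᵇ P (xs ++ ys) ≡ filterᵇ P xs ++ filterᵇ P ys
filterᵇ-++ P [] ys = refl
filterᵇ-++ P (x ∷ xs) ys with P x
... | true = cong (x ∷_) (filterᵇ-++ P xs ys)
... | false = filterᵇ-++ P xs ys

stepwise-increasing⇒< : (f : ℕ → ℕ) → (∀ j → f j < f (suc j)) → ∀ j k → j < k → f j < f k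
stepwise-increasing⇒< f inc j (suc k) j<1+k with m<1+n⇒m<n∨m≡n j<1+k
... | inj₁ j<k = <-trans (stepwise-increasing⇒< f inc j k j<k) (inc k)
... | inj₂ refl = inc j

filterᵇ-upTo≡map : (P : ℕ → Bool) (f : ℕ → ℕ) → (∀ j → f j < f (suc j)) → ∀ M K →
  (∀ j → j < K → f j < M) → (∀ j → j < K → P (f j) ≡ true) →
  (∀ c → c < M → P c ≡ true → ∃ λ j → j < K × f j ≡ c) →
  filterᵇ P (upTo M) ≡ List.map f (upTo K)
filterᵇ-upTo≡map P f inc zero zero _ _ _ = refl
filterᵇ-upTo≡map P f inc zero (suc K) <M _ _ = ⊥-elim (<⇒≱ (<M 0 (s≤s z≤n)) z≤n)
filterᵇ-upTo≡map P f inc (suc M) K <M holds onto = begin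
  filterᵇ P (upTo (suc M))                  ≡⟨ cong (filterᵇ P) (sym (List.upTo-∷ʳ M)) ⟩
  filterᵇ P (upTo M ++ M ∷ [])              ≡⟨ filterᵇ-++ P (upTo M) (M ∷ []) ⟩
  filterᵇ P (upTo M) ++ filterᵇ P (M ∷ [])  ≡⟨ lastStep ⟩
  List.map f (upTo K)                       ∎
  where
  open ≡-Reasoning
  onto′ : ∀ c → c < M → P c ≡ true → ∃ λ j → j < K × f j ≡ c
  onto′ c c<M = onto c (m≤n⇒m≤1+n c<M)
  lastStep : filterᵇ P (upTo M) ++ filterᵇ P (M ∷ []) ≡ List.map f (upTo K)
  lastStep with P M in PM
  ... | false = trans (List.++-identityʳ _) (filterᵇ-upTo≡map P f inc M K <M′ holds onto′)
    where
    <M′ : ∀ j → j < K → f j < M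
    <M′ j j<K = [ id , (λ fj≡M → ⊥-elim (true≢false (trans (sym (holds j j<K)) (trans (cong P fj≡M) PM)))) ]′
                  (m<1+n⇒m<n∨m≡n (<M j j<K))
  ... | true with onto M ≤-refl PM
  ...   | j , j<K , fj≡M = subst (λ K → filterᵇ P (upTo M) ++ M ∷ [] ≡ List.map f (upTo K)) (sym K≡1+j) (begin
    filterᵇ P (upTo M) ++ M ∷ []          ≡⟨ cong₂ (λ xs x → xs ++ x ∷ []) earlier (sym fj≡M) ⟩
    List.map f (upTo j) ++ f j ∷ []       ≡⟨ sym (List.map-++ f (upTo j) (j ∷ [])) ⟩
    List.map f (upTo j ++ j ∷ [])         ≡⟨ cong (List.map f) (List.upTo-∷ʳ j) ⟩
    List.map f (upTo (suc j))             ∎)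
    where
    K≡1+j : K ≡ suc j
    K≡1+j = ≤-antisym (≮⇒≥ λ 1+j<K → <⇒≱ (<M (suc j) 1+j<K) (subst (λ x → suc x ≤ f (suc j)) fj≡M (inc j))) j<K
    earlier : filterᵇ P (upTo M) ≡ List.map f (upTo j)
    earlier = filterᵇ-upTo≡map P f inc M j
      (λ j′ j′<j → subst (f j′ <_) fj≡M (stepwise-increasing⇒< f inc j′ j j′<j))
      (λ j′ j′<j → holds j′ (subst (j′ <_) (sym K≡1+j) (m≤n⇒m≤1+n j′<j)))
      (λ c c<M Pc → case onto′ c c<M Pc of λ where
         (j′ , j′<K , fj′≡c) → [ (λ j′<j → j′ , j′<j , fj′≡c)
                                 , (λ { refl → ⊥-elim (<-irrefl (trans (sym fj′≡c) fj≡M) c<M) }) ]′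
                                 (m<1+n⇒m<n∨m≡n (subst (j′ <_) K≡1+j j′<K)))

prodQ-if≡prodQ-filterᵇ : (P : ℕ → Bool) (f : ℕ → ℚ) (L : List ℕ) →
  prodQ (List.map (λ c → if P c then f c else 1ℚ) L) ≡ prodQ (List.map f (filterᵇ P L))
prodQ-if≡prodQ-filterᵇ P f [] = refl
prodQ-if≡prodQ-filterᵇ P f (x ∷ L) with P x
... | true = cong (f x ℚ.*_) (prodQ-if≡prodQ-filterᵇ P f L)
... | false = trans (ℚP.*-identityˡ _) (prodQ-if≡prodQ-filterᵇ P f L)

tabulate-toℕ : ∀ m (h : ℕ → A) → tabulate {n = m} (h ∘ toℕ) ≡ List.map h (upTo m)
tabulate-toℕ m h = trans (applyUpTo≡ m h) (sym (List.map-upTo h m))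
  where
  applyUpTo≡ : ∀ m (h : ℕ → A) → tabulate {n = m} (h ∘ toℕ) ≡ applyUpTo h m
  applyUpTo≡ zero h = refl
  applyUpTo≡ (suc m) h = cong (h 0 ∷_) (applyUpTo≡ m (h ∘ suc))

module Hooks (n : ℕ) (la : Fin n → ℕ) (isPartition : IsPartition la) where
  open Partition n la isPartition

  conj-threshold : ∀ J → IsThreshold n (λ k → J ≤ part k) (conj la J)
  conj-threshold J = subst (IsThreshold n (λ k → J ≤ part k)) (sym conj≡t) (t≤n , thr)
    where
    closed : ∀ k k′ → k′ ≤ k → J ≤ part k → J ≤ part k′
    closed k k′ k′≤k J≤ with k <? n
    ... | yes k<n = ≤-trans J≤ (part-antitone k′ k k′≤k k<n)
    ... | no k≮n = ≤-trans (≤-trans J≤ (≤-reflexive (extend-beyond n la 0 k (≮⇒≥ k≮n)))) z≤n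
    found = threshold (λ k → J ≤? part k) closed n
    t = proj₁ found
    t≤n = proj₁ (proj₂ found)
    thr = proj₂ (proj₂ found)
    conj≡t : conj la J ≡ t
    conj≡t = length-filter-prefix (λ k → J ≤? la k) n id t t≤n λ k →
        (λ J≤ → proj₁ (thr (toℕ k) (toℕ<n k)) (subst (J ≤_) (sym (extend-toℕ la 0 k)) J≤))
      , (λ k<t → subst (J ≤_) (extend-toℕ la 0 k) (proj₂ (thr (toℕ k) (toℕ<n k)) k<t))

  conj-antitone : ∀ J → conj la (suc J) ≤ conj la J
  conj-antitone J = threshold-mono (≤-trans (n≤1+n J)) (conj-threshold (suc J)) (conj-threshold J)

  hookColumn : ℕ → ℕ
  hookColumn j = (n ∸ conj la (suc j)) + j

  hookColumn-increasing : ∀ j → hookColumn j < hookColumn (suc j)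
  hookColumn-increasing j = +-mono-≤-< (∸-monoʳ-≤ n (conj-antitone (suc j))) (n<1+n j)

  hookColumn≢column : ∀ j m → m < n → hookColumn j ≢ column m
  hookColumn≢column j m m<n with m <? conj la (suc j)
  ... | yes m<t = λ e → <-irrefl e (subst (hookColumn j <_) (+-comm (n ∸ suc m) (part m))
        (+-mono-≤-< (∸-monoʳ-≤ n m<t) (proj₂ (proj₂ (conj-threshold (suc j)) m m<n) m<t)))
  ... | no m≮t = λ e → <-irrefl (sym e) (subst (column m <_) (+-comm j (n ∸ conj la (suc j)))
        (+-mono-≤-< (≮⇒≥ (m≮t ∘ proj₁ (proj₂ (conj-threshold (suc j)) m m<n))) (∸-monoʳ-< (≰⇒> m≮t) m<n)))

  hookColumn≤column : ∀ i → i < n → ∀ j → j < part i → hookColumn j ≤ column i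
  hookColumn≤column i i<n j j<part = subst (hookColumn j ≤_) (+-comm (n ∸ suc i) (part i))
    (+-mono-≤ (∸-monoʳ-≤ n (proj₁ (proj₂ (conj-threshold (suc j)) i i<n) j<part)) (<⇒≤ j<part))

  -- A column c left of the exit of row i and missed by the exits of rows ≥ i: with t the
  -- number of exits right of c, c is the hook column of j = c − (n − t), and λ′_{j+1} = t.
  module Gap (i : ℕ) (i<n : i < n) (c : ℕ) (c<col : c < column i)
             (missed : ∀ m → i ≤ m → m < n → c ≢ column m) where

    closed : ∀ k k′ → k′ ≤ k → c < column k → c < column k′
    closed k k′ k′≤k c< with k <? n
    ... | no k≮n = ⊥-elim (<⇒≱ (subst (c <_) (cong₂ _+_ (extend-beyond n la 0 k (≮⇒≥ k≮n))
                                                        (m≤n⇒m∸n≡0 (m≤n⇒m≤1+n (≮⇒≥ k≮n)))) c<) z≤n)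
    ... | yes k<n = [ (λ k′<k → <-trans c< (column-decreasing k′ k k′<k k<n)) , (λ { refl → c< }) ]′ (m≤n⇒m<n∨m≡n k′≤k)

    found = threshold (λ k → c <? column k) closed n
    t = proj₁ found
    t≤n = proj₁ (proj₂ found)
    thr = proj₂ (proj₂ found)

    i<t : i < t
    i<t = proj₁ (thr i i<n) c<col

    right : ∀ k → t ≤ k → k < n → column k < c
    right k t≤k k<n = [ id , (λ col≡c → ⊥-elim (missed k (<⇒≤ (<-≤-trans i<t t≤k)) k<n (sym col≡c))) ]′
      (m≤n⇒m<n∨m≡n (≮⇒≥ λ c<col → <⇒≱ (proj₁ (thr k k<n) c<col) t≤k))

    u = n ∸ t

    u≤c : u ≤ c
    u≤c = [ (λ t<n → subst (_≤ c) (sym (∸-suc t<n)) (≤-trans (s≤s (m≤n+m (n ∸ suc t) (part t))) (right t ≤-refl t<n)))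
          , (λ t≡n → subst (λ x → n ∸ x ≤ c) (sym t≡n) (subst (_≤ c) (sym (n∸n≡0 n)) z≤n)) ]′ (m≤n⇒m<n∨m≡n t≤n)

    j = c ∸ u

    part≤j : t < n → part t ≤ j
    part≤j t<n = m+n≤o⇒m≤o∸n (part t)
      (subst (_≤ c) (trans (sym (+-suc (part t) (n ∸ suc t))) (cong (part t +_) (sym (∸-suc t<n)))) (right t ≤-refl t<n))

    j<part : ∀ k → k < n → k < t → suc j ≤ part k
    j<part k k<n k<t = ≤-trans (subst (c ∸ u <_) (m+n∸n≡m (part t′) u) (∸-monoˡ-< c<col′ u≤c))
                               (part-antitone k t′ (≤-pred (subst (k <_) (sym 1+t′≡t) k<t)) t′<n)
      where
      t′ = ℕ.pred t
      1+t′≡t : suc t′ ≡ t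
      1+t′≡t = suc-pred t {{ℕ.>-nonZero (≤-<-trans z≤n k<t)}}
      t′<n : t′ < n
      t′<n = <-≤-trans (subst (t′ <_) 1+t′≡t ≤-refl) t≤n
      c<col′ : c < part t′ + u
      c<col′ = subst (λ x → c < part t′ + (n ∸ x)) 1+t′≡t (proj₂ (thr t′ t′<n) (subst (t′ <_) 1+t′≡t ≤-refl))

    part>j⇒<t : ∀ k → k < n → suc j ≤ part k → k < t
    part>j⇒<t k k<n j<part = ≰⇒> λ t≤k → <⇒≱ j<part (≤-trans (part-antitone t k t≤k k<n) (part≤j (≤-<-trans t≤k k<n)))

    gap⇒hookColumn : ∃ λ j → j < part i × hookColumn j ≡ c
    gap⇒hookColumn = j , j<part i i<n i<t , trans (cong (λ x → (n ∸ x) + j) conj≡t) (m+[n∸m]≡n u≤c)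
      where
      conj≡t : conj la (suc j) ≡ t
      conj≡t = threshold-unique (conj-threshold (suc j)) (t≤n , λ k k<n → part>j⇒<t k k<n , j<part k k<n)

  open Gap using (gap⇒hookColumn) public

module Evaluation (n : ℕ) (1≤n : 1 ≤ n) (la : Fin n → ℕ) (isPartition-la : IsPartition la)
                  (a : ℕ → ℚ) (a≢0 : ∀ c → a c ≢ 0ℚ) where

  N : ℕ
  N = n + firstPart la

  open Partition n la isPartition-la

  column<N : ∀ k → k < n → column k < N
  column<N k k<n = subst (column k <_) (sym (cong (n +_) (firstPart≡part0 n la 1≤n))) (column<n+part0 k k<n)

  open Occupancy n column column-decreasing

  bit-exit≡hits : ∀ c → bit (inPartCols la (suc c)) ≡ hits 0 c
  bit-exit≡hits c = begin
    bit (BLA.or (List.map exits-at (tabulate id)))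
      ≡⟨ cong (bit ∘ BLA.or) (List.map-tabulate id exits-at) ⟩
    bit (BLA.or (tabulate exits-at))
      ≡⟨ bit-or-tabulate n exits-at (subst (_≤ 1) (sym sum≡hits) (hits≤1 0 c)) ⟩
    sumFrom (bit ∘ extend exits-at false) 0 n
      ≡⟨ sum≡hits ⟩
    hits 0 c ∎
    where
    open ≡-Reasoning
    exits-at : Fin n → Bool
    exits-at k = suc c ≡ᵇ la k + (n ∸ toℕ k)
    sum≡hits : sumFrom (bit ∘ extend exits-at false) 0 n ≡ hits 0 c
    sum≡hits = sumFrom-cong _ _ 0 n λ j _ j<n → cong bit (trans (extend-< exits-at false j j<n)
      (cong (suc c ≡ᵇ_) (trans (sym (suc-column (fromℕ< j<n))) (cong (λ j → suc (column j)) (toℕ-fromℕ< j<n)))))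

  -- The path entering row r runs east up to its exit column and then straight up.
  groundState : State n N
  groundState = st (λ r k → not (toℕ k ≤ᵇ column (toℕ r))) (λ k c → 1 ≤ᵇ hits (toℕ k) (toℕ c))

  bit-groundV : ∀ k c → bit (V groundState k c) ≡ hits (toℕ k) (toℕ c)
  bit-groundV k c = bit-1≤ᵇ (hits≤1 (toℕ k) (toℕ c))

  groundState-valid : validState la groundState ≡ true
  groundState-valid =
    ∧-intro (allB-intro (λ r → allB (vertexOK groundState r)) λ r → allB-intro (vertexOK groundState r) λ c →
              balance⇒iceRule (H groundState r (inject₁ c)) (H groundState r (suc c))
                              (V groundState (inject₁ r) c) (V groundState (suc r) c) (balanced r c))
    (∧-intro (allB-intro (λ r → not (H groundState r zero)) λ r → refl)
    (∧-intro (allB-intro (λ r → H groundState r (fromℕ N)) λ r →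
               cong not (trans (cong (_≤ᵇ column (toℕ r)) (toℕ-fromℕ N)) (≤ᵇ-false N _ (column<N (toℕ r) (toℕ<n r)))))
    (∧-intro (allB-intro (λ c → not (V groundState (fromℕ n) c)) λ c →
               cong not (bit-injective _ false (trans (bit-groundV (fromℕ n) c)
                                                      (hits-beyond _ (toℕ c) (≤-reflexive (sym (toℕ-fromℕ n)))))))
             (allB-intro (λ c → boolEq (not (V groundState zero c)) (not (inPartCols la (suc (toℕ c))))) λ c →
               subst (λ b → boolEq (not b) (not (inPartCols la (suc (toℕ c)))) ≡ true)
                     (sym (bit-injective _ _ (trans (bit-groundV zero c) (sym (bit-exit≡hits (toℕ c))))))
                     (boolEq-refl (not (inPartCols la (suc (toℕ c)))))))))
    where
    balanced : ∀ r c → bit (not (H groundState r (inject₁ c))) + bit (V groundState (suc r) c)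
                     ≡ bit (not (H groundState r (suc c))) + bit (V groundState (inject₁ r) c)
    balanced r c = begin
      bit (not (not (toℕ (inject₁ c) ≤ᵇ Q))) + bit (V groundState (suc r) c)
        ≡⟨ cong₂ _+_ (cong bit (trans (not-involutive _) (cong (_≤ᵇ Q) (toℕ-inject₁ c)))) (bit-groundV (suc r) c) ⟩
      bit (toℕ c ≤ᵇ Q) + hits (suc i) (toℕ c)
        ≡⟨ cong (_+ hits (suc i) (toℕ c)) (≤ᵇ-split (toℕ c) Q) ⟩
      bit (toℕ c ≡ᵇ Q) + bit (suc (toℕ c) ≤ᵇ Q) + hits (suc i) (toℕ c)
        ≡⟨ solve 3 (λ x y h → (x :+ y) :+ h := y :+ (x :+ h)) refl
             (bit (toℕ c ≡ᵇ Q)) (bit (suc (toℕ c) ≤ᵇ Q)) (hits (suc i) (toℕ c)) ⟩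
      bit (suc (toℕ c) ≤ᵇ Q) + (bit (toℕ c ≡ᵇ Q) + hits (suc i) (toℕ c))
        ≡⟨ cong₂ _+_ (cong bit (sym (not-involutive _))) (sym (hits-step i (toℕ c) (toℕ<n r))) ⟩
      bit (not (not (suc (toℕ c) ≤ᵇ Q))) + hits i (toℕ c)
        ≡⟨ cong (bit (not (H groundState r (suc c))) +_)
             (sym (trans (bit-groundV (inject₁ r) c) (cong (λ k → hits k (toℕ c)) (toℕ-inject₁ r)))) ⟩
      bit (not (H groundState r (suc c))) + bit (V groundState (inject₁ r) c) ∎
      where
      open ≡-Reasoning
      i = toℕ r
      Q = column i

  module ValidState (z : State n N) (valid : validState la z ≡ true) where
    open Arrays z public
    open Valid la valid public

    exits : ∀ k → k < n → vb 0 (column k) ≡ true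
    exits k k<n = trans (north (column k) (column<N k k<n))
      (anyB-intro (λ k′ → suc (column k) ≡ᵇ la k′ + (n ∸ toℕ k′)) (fromℕ< k<n)
        (≡ᵇ-true _ _ (trans (cong (λ j → suc (column j)) (sym (toℕ-fromℕ< k<n))) (suc-column (fromℕ< k<n)))))

    weight-vanishes : (mu : Fin n → ℕ) (isPartition-mu : IsPartition mu) → ¬ (la ⊆ₚ mu) →
      stateWeight (aSub a mu) a z ≡ 0ℚ
    weight-vanishes mu isPartition-mu la⊈mu = [ atZeroVertex , ⊥-elim ∘ la⊈mu ∘ dominated ]′ (boundedSearch zeroVertex? n)
      where
      module M = Partition n mu isPartition-mu
      open Lattice n N vb hb M.column M.column-decreasing balance east south
      atZeroVertex : (∃ λ r → r < n × ZeroVertex r) → stateWeight (aSub a mu) a z ≡ 0ℚ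
      atZeroVertex (r , r<n , col<N , north-free , south-free , west-bound) =
        zeroVertex⇒stateWeight≡0 z a a≢0 mu isPartition-mu r r<n col<N north-free south-free west-bound
      dominated : (∀ r → r < n → ¬ ZeroVertex r) → la ⊆ₚ mu
      dominated none i = subst₂ _≤_ (extend-toℕ la 0 i) (extend-toℕ mu 0 i)
        (+-cancelʳ-≤ (n ∸ suc (toℕ i)) _ _
          (noZeroVertex⇒dominated column column-decreasing column<N exits none (toℕ i) (toℕ<n i)))

    weight-vanishes-off-ground : ¬ SameState z groundState → stateWeight (aSub a la) a z ≡ 0ℚ
    weight-vanishes-off-ground ¬ground = [ atZeroVertex , ⊥-elim ∘ ¬ground ∘ ground ]′ (boundedSearch zeroVertex? n)
      where
      open Lattice n N vb hb column column-decreasing balance east south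
      atZeroVertex : (∃ λ r → r < n × ZeroVertex r) → stateWeight (aSub a la) a z ≡ 0ℚ
      atZeroVertex (r , r<n , col<N , north-free , south-free , west-bound) =
        zeroVertex⇒stateWeight≡0 z a a≢0 la isPartition-la r r<n col<N north-free south-free west-bound
      ground : (∀ r → r < n → ¬ ZeroVertex r) → SameState z groundState
      ground none = sameH , sameV
        where
        open Determined column<N (λ c c<N → trans (cong bit (north c c<N)) (bit-exit≡hits c)) none
        sameH : ∀ r k → H z r k ≡ H groundState r k
        sameH r k = trans (sym (not-involutive _))
          (cong not (trans (sym (hb-toℕ r k)) (hb-determined (toℕ r) (toℕ k) (toℕ<n r) (≤-pred (toℕ<n k)))))
        sameV : ∀ k c → V z k c ≡ V groundState k c
        sameV k c = bit-injective _ _ (trans (cong bit (sym (vb-toℕ k c)))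
          (trans (vb-determined (toℕ k) (toℕ c) (≤-pred (toℕ<n k)) (toℕ<n c)) (sym (bit-groundV k c))))


  vanishing : (mu : Fin n → ℕ) → IsPartition mu → ¬ (la ⊆ₚ mu) → Z n la (aSub a mu) a ≡ 0ℚ
  vanishing mu isPartition-mu la⊈mu =
    trans (sumQ-filter (validState la) _ (allStates n N)) (sumQ-zero _ (allStates n N) onValid)
    where
    onValid : ∀ z → (if validState la z then stateWeight (aSub a mu) a z else 0ℚ) ≡ 0ℚ
    onValid z with validState la z in valid
    ... | true = ValidState.weight-vanishes z valid mu isPartition-mu la⊈mu
    ... | false = refl

  Z≡groundWeight : Z n la (aSub a la) a ≡ stateWeight (aSub a la) a groundState
  Z≡groundWeight = begin
    Z n la (aSub a la) a                       ≡⟨ sumQ-filter (validState la) weight (allStates n N) ⟩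
    sumQ (List.map restricted (allStates n N)) ≡⟨ allStates-isolates n N groundState restricted off on ⟩
    restricted groundState                     ≡⟨ cong (λ b → if b then weight groundState else 0ℚ) groundState-valid ⟩
    weight groundState                         ∎
    where
    open ≡-Reasoning
    weight : State n N → ℚ
    weight = stateWeight (aSub a la) a
    restricted : State n N → ℚ
    restricted z = if validState la z then weight z else 0ℚ
    off : ∀ z → ¬ SameState z groundState → restricted z ≡ 0ℚ
    off z ¬ground with validState la z in valid
    ... | true = ValidState.weight-vanishes-off-ground z valid ¬ground
    ... | false = refl
    on : ∀ z → SameState z groundState → restricted z ≡ restricted groundState
    on z same rewrite sameState⇒validState≡ same la | sameState⇒stateWeight≡ same (aSub a la) a = refl

  open Hooks n la isPartition-la

  northWest : ℕ → ℕ → Bool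
  northWest i c = not (1 ≤ᵇ hits i c) ∧ (c ≤ᵇ column i)

  northWest-columns : ∀ i → i < n → filterᵇ (northWest i) (upTo N) ≡ List.map hookColumn (upTo (part i))
  northWest-columns i i<n = filterᵇ-upTo≡map (northWest i) hookColumn hookColumn-increasing N (part i)
    (λ j j<part → ≤-<-trans (hookColumn≤column i i<n j j<part) (column<N i i<n)) holds onto
    where
    holds : ∀ j → j < part i → northWest i (hookColumn j) ≡ true
    holds j j<part = cong₂ _∧_ (cong (not ∘ (1 ≤ᵇ_)) hits≡0) (≤ᵇ-true _ _ (hookColumn≤column i i<n j j<part))
      where
      hits≡0 : hits i (hookColumn j) ≡ 0
      hits≡0 = sumFrom-zero _ i (n ∸ i) λ m i≤m m< →
        cong bit (≡ᵇ-false _ _ (hookColumn≢column j m (<+∸⇒< n i m i≤m m<)))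
    onto : ∀ c → c < N → northWest i c ≡ true → ∃ λ j → j < part i × hookColumn j ≡ c
    onto c _ nw = gap⇒hookColumn i i<n c c<col missed
      where
      1≰hits : (1 ≤ᵇ hits i c) ≡ false
      1≰hits = trans (sym (not-involutive _)) (cong not (∧-trueˡ nw))
      missed : ∀ m → i ≤ m → m < n → c ≢ column m
      missed m i≤m m<n c≡col = true≢false (trans (sym (≤ᵇ-true 1 (hits i c) hit)) 1≰hits)
        where
        hit : 1 ≤ hits i c
        hit = sumFrom-pos _ i (n ∸ i) m i≤m (subst (m <_) (sym (m+[n∸m]≡n (<⇒≤ i<n))) m<n)
                (≤-reflexive (sym (cong bit (≡ᵇ-true c (column m) c≡col))))
      c<col : c < column i
      c<col = [ id , (λ c≡col → ⊥-elim (missed i ≤-refl i<n c≡col)) ]′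
        (m≤n⇒m<n∨m≡n (≤ᵇ⇒≤ c (column i) (subst T (sym (∧-trueʳ (not (1 ≤ᵇ hits i c)) nw)) tt)))

  -- In the ground state no vertex has its hydrogens north and south, since a path crossing
  -- below row r also crosses above it.
  groundWeight-vertex : ∀ r c → vertexWeight (aSub a la) a groundState r c
    ≡ (if northWest (toℕ r) (toℕ c) then divQ (aSub a la r) (a (suc (toℕ c))) ℚ.- 1ℚ else 1ℚ)
  groundWeight-vertex r c = begin
    (if bN′ ∧ bS′ then X else if bN′ ∧ bW′ then X ℚ.- 1ℚ else 1ℚ)
      ≡⟨ cong (λ b → if b then X else if bN′ ∧ bW′ then X ℚ.- 1ℚ else 1ℚ) northSouth≡false ⟩
    (if bN′ ∧ bW′ then X ℚ.- 1ℚ else 1ℚ)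
      ≡⟨ cong₂ (λ nn w → if nn ∧ w then X ℚ.- 1ℚ else 1ℚ)
           (cong (λ k → not (1 ≤ᵇ hits k (toℕ c))) (toℕ-inject₁ r))
           (trans (not-involutive _) (cong (_≤ᵇ column (toℕ r)) (toℕ-inject₁ c))) ⟩
    (if northWest (toℕ r) (toℕ c) then X ℚ.- 1ℚ else 1ℚ) ∎
    where
    open ≡-Reasoning
    X = divQ (aSub a la r) (a (suc (toℕ c)))
    bN′ = bN groundState r c
    bS′ = bS groundState r c
    bW′ = bW groundState r c
    northSouth≡false : bN′ ∧ bS′ ≡ false
    northSouth≡false rewrite toℕ-inject₁ r with hits (suc (toℕ r)) (toℕ c) in below
    ... | zero = ∧-zeroʳ _
    ... | suc k rewrite hits-step (toℕ r) (toℕ c) (toℕ<n r) | below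
                      | ≤ᵇ-true 1 (bit (toℕ c ≡ᵇ column (toℕ r)) + suc k) (≤-trans (s≤s z≤n) (m≤n+m (suc k) _)) = refl

  groundState-row : ∀ r → prodQ (List.map (vertexWeight (aSub a la) a groundState r) (List.allFin N))
    ≡ prodQ (List.map (λ j → divQ (a (la r + (n ∸ toℕ r))) (a ((n ∸ conj la j) + j)) ℚ.- 1ℚ) (List.map suc (upTo (la r))))
  groundState-row r = begin
    prodQ (List.map (vertexWeight (aSub a la) a groundState r) (List.allFin N))
      ≡⟨ cong prodQ (List.map-cong (groundWeight-vertex r) (List.allFin N)) ⟩
    prodQ (List.map (λ c → if northWest i (toℕ c) then factor (toℕ c) else 1ℚ) (List.allFin N))
      ≡⟨ cong prodQ (trans (List.map-tabulate id _) (tabulate-toℕ N (λ c → if northWest i c then factor c else 1ℚ))) ⟩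
    prodQ (List.map (λ c → if northWest i c then factor c else 1ℚ) (upTo N))
      ≡⟨ prodQ-if≡prodQ-filterᵇ (northWest i) factor (upTo N) ⟩
    prodQ (List.map factor (filterᵇ (northWest i) (upTo N)))
      ≡⟨ cong (prodQ ∘ List.map factor) (northWest-columns i (toℕ<n r)) ⟩
    prodQ (List.map factor (List.map hookColumn (upTo (part i))))
      ≡⟨ cong prodQ (trans (sym (List.map-∘ (upTo (part i))))
                           (trans (List.map-cong (λ j → cong (λ x → divQ (aSub a la r) (a x) ℚ.- 1ℚ) (sym (+-suc _ j)))
                                                 (upTo (part i)))
                                  (List.map-∘ (upTo (part i))))) ⟩
    prodQ (List.map hook (List.map suc (upTo (part i))))
      ≡⟨ cong (λ K → prodQ (List.map hook (List.map suc (upTo K)))) (extend-toℕ la 0 r) ⟩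
    prodQ (List.map hook (List.map suc (upTo (la r)))) ∎
    where
    open ≡-Reasoning
    i = toℕ r
    factor : ℕ → ℚ
    factor c = divQ (aSub a la r) (a (suc c)) ℚ.- 1ℚ
    hook : ℕ → ℚ
    hook j = divQ (a (la r + (n ∸ toℕ r))) (a ((n ∸ conj la j) + j)) ℚ.- 1ℚ

  groundState-weight : stateWeight (aSub a la) a groundState ≡ hookProd a la
  groundState-weight = cong prodQ (List.map-cong groundState-row (List.allFin n))

mainTheorem7 : (n : ℕ) → 1 ≤ n → (la mu : Fin n → ℕ) → IsPartition la → IsPartition mu →
    (a : ℕ → ℚ) → (∀ c → a c ≢ 0ℚ) →
    (¬ (la ⊆ₚ mu) → Z n la (aSub a mu) a ≡ 0ℚ) × (Z n la (aSub a la) a ≡ hookProd a la)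
mainTheorem7 n 1≤n la mu isPartition-la isPartition-mu a a≢0 =
  vanishing mu isPartition-mu , trans Z≡groundWeight groundState-weight
  where open Evaluation n 1≤n la isPartition-la a a≢0
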